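{- Let $q$ be a power of $2$ and let $d$ be the minimum distance of the binary code $\mathcal{C}(2,q)$. Then $d\le 4q$.
   Context: $\mathbb{S}_2(\mathbb{F}_q)$ denotes the set of $2\times 2$ symmetric matrices over $\mathbb{F}_q$ (its elements are called points). Two points $S,S'$ are adjacent if $\operatorname{rank}(S-S')=1$. A line is a maximal set of rank $1$: a subset $\mathcal{M}\subseteq\mathbb{S}_2(\mathbb{F}_q)$ such that any two distinct points of $\mathcal{M}$ are adjacent and no point of $\mathbb{S}_2(\mathbb{F}_q)\setminus\mathcal{M}$ is adjacent to every point of $\mathcal{M}$. $H(2,q)$ is the binary matrix with rows indexed by the lines and columns indexed by the points, whose (line, point) entry is $1$ iff the point belongs to the line. $\mathcal{C}(2,q)=\{c\in\mathbb{F}_2^{\text{points}}: H(2,q)c=0\}$. -}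

module Defs where

open import Level using (0ℓ)
open import Data.Nat using (ℕ; _≤_)
open import Data.Nat.Divisibility using (_∣_)
open import Data.Fin using (Fin)
open import Data.Bool using (Bool; true; false; _∧_)
import Data.List
open Data.List using (List; map; allFin; filterᵇ; length)
open import Data.Product using (_×_; _,_; Σ; ∃)
open import Relation.Nullary using (¬_)
open import Relation.Binary.PropositionalEquality using (_≡_)
open import Algebra.Structures using (IsCommutativeRing)
open import Function.Bundles using (_⤖_; Bijection)

record FiniteField (q : ℕ) : Set₁ where
  field
    Carrier : Set
    _+_ _*_ : Carrier → Carrier → Carrier
    -_      : Carrier → Carrier
    0# 1#   : Carrier
    isCommutativeRing : IsCommutativeRing _≡_ _+_ _*_ -_ 0# 1#
    0≢1     : ¬ (0# ≡ 1#)
    inverse : ∀ x → ¬ (x ≡ 0#) → Σ Carrier (λ y → x * y ≡ 1#)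
    enum    : Fin q ⤖ Carrier
  infixl 6 _+_
  infixl 7 _*_

module _ {q : ℕ} (F : FiniteField q) where
  open FiniteField F

  elements : List Carrier
  elements = map (Bijection.to enum) (allFin q)

  -- A point of S₂(F_q): the symmetric matrix [[a , b] , [b , c]] is (a , b , c).
  Point : Set
  Point = Carrier × Carrier × Carrier

  allPoints : List Point
  allPoints = Data.List.concatMap (λ a → Data.List.concatMap (λ b → map (λ c → (a , b , c)) elements) elements) elements

  _−ₚ_ : Point → Point → Point
  (a , b , c) −ₚ (a' , b' , c') = (a + (- a')) , (b + (- b')) , (c + (- c'))

  det : Point → Carrier
  det (a , b , c) = (a * c) + (- (b * b))

  zeroPoint : Point
  zeroPoint = 0# , 0# , 0#

  -- rank of a 2×2 matrix equals 1 iff it is nonzero and has zero determinant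
  Rank1 : Point → Set
  Rank1 S = ¬ (S ≡ zeroPoint) × (det S ≡ 0#)

  Adjacent : Point → Point → Set
  Adjacent S S' = Rank1 (S −ₚ S')

  IsLine : (Point → Bool) → Set
  IsLine M =
    (∀ S S' → M S ≡ true → M S' ≡ true → ¬ (S ≡ S') → Adjacent S S')
    × (∀ S → M S ≡ false → ¬ (∀ S' → M S' ≡ true → Adjacent S S'))

  card : (Point → Bool) → ℕ
  card P = length (filterᵇ P allPoints)

  -- c ∈ C(2,q): over F₂, H(2,q) c = 0 iff every line meets supp(c) in an even number of points
  IsCodeword : (Point → Bool) → Set
  IsCodeword c = ∀ M → IsLine M → 2 ∣ card (λ S → M S ∧ c S)

  weight : (Point → Bool) → ℕ
  weight = card

  Nonzero : (Point → Bool) → Set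
  Nonzero c = ∃ λ S → c S ≡ true

  MinDistanceAtMost : ℕ → Set
  MinDistanceAtMost n = ∃ λ c → IsCodeword c × Nonzero c × weight c ≤ n

-- Since q is even, F has characteristic 2: otherwise x ↦ - x would pair off the nonzero
-- elements and q would be odd. The codeword is the set of [[a , b] , [b , c]] with a ∈ {0 , 1}
-- and c + b² ∈ {0 , 1}; it contains 0 and has at most 2 · q · 2 points. Two points of a line
-- differ by a rank-one matrix R, and a singular S with R + S singular is a multiple of R, so a
-- line through P is the affine line P + F R. On it, by Frobenius and r₁ r₃ = r₂², the two
-- conditions cut out exactly the parameters μ with μ ℓ ∈ {0 , 1} for some ℓ ≢ 0. Hence every
-- line meets the codeword in 0 or 2 points.
module Submission where

open import Defs
open import Level using (0ℓ)
open import Algebra.Bundles using (CommutativeRing)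
import Algebra.Properties.Ring
import Algebra.Solver.Ring.NaturalCoefficients.Default
open import Algebra.Structures using (IsCommutativeRing)
open import Data.Bool using (Bool; true; false; T; _∧_)
open import Data.Bool.Properties using (T-≡)
import Data.Bool.Properties as Bool
open import Data.Empty using (⊥-elim)
import Data.Fin as Fin
open import Data.Fin.Properties using (pigeonhole; <⇒≢)
open import Data.List using (allFin; List; []; _∷_; _++_; map; concatMap; length; filter; filterᵇ; lookup)
open import Data.List.Properties using (length-tabulate; length-map; length-++; filter-notAll; filter-none)
open import Data.List.Membership.Propositional using (_∈_; lose; find)
open import Data.List.Membership.Propositional.Properties using (∈-map⁻; ∈-concatMap⁺; ∈-concatMap⁻; ∈-map⁺; ∈-allFin; ∈-lookup; ∈-filter⁺; ∈-filter⁻)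
open import Data.List.Relation.Binary.Disjoint.Propositional using (Disjoint)
open import Data.List.Relation.Binary.Subset.Propositional using (_⊆_)
open import Data.List.Relation.Unary.All as All using ([]; _∷_)
open import Data.List.Relation.Unary.All.Properties using (¬Any⇒All¬)
import Data.List.Relation.Unary.All.Properties as Allₚ
open import Data.List.Relation.Unary.AllPairs as AllPairs using ([]; _∷_)
import Data.List.Relation.Unary.AllPairs.Properties as AllPairsₚ
open import Data.List.Relation.Unary.Any as Any using (Any; here; there; any?)
open import Data.List.Relation.Unary.Any.Properties using (lookup-index)
open import Data.List.Relation.Unary.Unique.Propositional using (Unique)
import Data.List.Relation.Unary.Unique.Propositional.Properties as Uniqueₚ
import Data.Nat as ℕ
open ℕ using (ℕ; suc; _≤_; s≤s)
open import Data.Nat.Divisibility using (_∣_; divides; _∣0; ∣m∣n⇒∣m+n; ∣m+n∣m⇒∣n; ∣1⇒≡1; ∣-refl; m∣m*n)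
import Data.Nat.Properties as ℕₚ
open ℕₚ using (≤-reflexive; ≤-antisym; ≮⇒≥; ≤-refl; ≤-trans; <⇒≤)
open import Data.Product as Product using (_×_; _,_; proj₁; proj₂; ∃)
open import Data.Product.Properties using (≡-dec)
open import Data.Sum as Sum using (_⊎_; inj₁; inj₂)
open import Function using (_∘_; id)
open import Function.Bundles using (_⇔_; mk⇔; Equivalence; Bijection)
open import Function.Construct.Composition using (_⇔-∘_)
open import Function.Properties.Bijection using (sym-≡)
open import Relation.Binary.Definitions using (DecidableEquality)
open import Relation.Binary.PropositionalEquality
open import Relation.Nullary using (¬_; Dec; yes; no; does; ¬?; contradiction)
open import Relation.Nullary.Decidable using (dec-true; T?; _×-dec_; _⊎-dec_; decidable-stable; via-injection)

does≡true⇒ : ∀ {A : Set} (a? : Dec A) → does a? ≡ true → A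
does≡true⇒ (yes a) _ = a
does≡true⇒ (no _) ()

module _ {A : Set} where

  lookup-injective : ∀ {xs : List A} → Unique xs → ∀ {i j} → lookup xs i ≡ lookup xs j → i ≡ j
  lookup-injective (_ ∷ _) {Fin.zero} {Fin.zero} _ = refl
  lookup-injective (x∉xs ∷ _) {Fin.zero} {Fin.suc j} eq = ⊥-elim (All.lookup x∉xs (∈-lookup j) eq)
  lookup-injective (x∉xs ∷ _) {Fin.suc i} {Fin.zero} eq = ⊥-elim (All.lookup x∉xs (∈-lookup i) (sym eq))
  lookup-injective (_ ∷ u) {Fin.suc i} {Fin.suc j} eq = cong Fin.suc (lookup-injective u eq)

  Unique-⊆⇒length-≤ : ∀ {xs ys : List A} → Unique xs → xs ⊆ ys → length xs ≤ length ys
  Unique-⊆⇒length-≤ {xs} {ys} u xs⊆ys = ≮⇒≥ λ ys<xs →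
    let i , j , i<j , same-position = pigeonhole ys<xs (Any.index ∘ at) in
    <⇒≢ i<j (lookup-injective u (begin
      lookup xs i                   ≡⟨ lookup-index (at i) ⟩
      lookup ys (Any.index (at i))  ≡⟨ cong (lookup ys) same-position ⟩
      lookup ys (Any.index (at j))  ≡⟨ lookup-index (at j) ⟨
      lookup xs j                   ∎))
    where
    open ≡-Reasoning
    at : ∀ i → lookup xs i ∈ ys
    at i = xs⊆ys (∈-lookup i)

  count : (A → Bool) → List A → ℕ
  count p xs = length (filterᵇ p xs)

  count-≡0 : ∀ {p : A → Bool} {xs} → ¬ Any (T ∘ p) xs → count p xs ≡ 0
  count-≡0 {p} {xs} none = cong length (filter-none (T? ∘ p) (¬Any⇒All¬ xs none))

  count-≡2 : ∀ {p : A → Bool} {xs x y} → Unique xs → x ∈ xs → y ∈ xs → x ≢ y →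
             (∀ z → p z ≡ true ⇔ (z ≡ x ⊎ z ≡ y)) → count p xs ≡ 2
  count-≡2 {p} {xs} {x} {y} u x∈xs y∈xs x≢y exactly-x-y = ≤-antisym
    (Unique-⊆⇒length-≤ (Uniqueₚ.filter⁺ (T? ∘ p) u) selected⊆xy)
    (Unique-⊆⇒length-≤ ((x≢y ∷ []) ∷ [] ∷ []) xy⊆selected)
    where
    selected⊆xy : filterᵇ p xs ⊆ x ∷ y ∷ []
    selected⊆xy z∈ with Equivalence.to (exactly-x-y _) (Equivalence.to T-≡ (proj₂ (∈-filter⁻ (T? ∘ p) {xs = xs} z∈)))
    ... | inj₁ refl = here refl
    ... | inj₂ refl = there (here refl)
    selected : ∀ {z} → z ∈ xs → z ≡ x ⊎ z ≡ y → z ∈ filterᵇ p xs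
    selected z∈xs is-x-y = ∈-filter⁺ (T? ∘ p) z∈xs (Equivalence.from T-≡ (Equivalence.from (exactly-x-y _) is-x-y))
    xy⊆selected : x ∷ y ∷ [] ⊆ filterᵇ p xs
    xy⊆selected (here refl) = selected x∈xs (inj₁ refl)
    xy⊆selected (there (here refl)) = selected y∈xs (inj₂ refl)

module _ {A : Set} (_≟_ : DecidableEquality A) where

  remove : A → List A → List A
  remove t = filter (λ y → ¬? (y ≟ t))

  length-remove : ∀ {t xs} → Unique xs → t ∈ xs → length xs ≡ suc (length (remove t xs))
  length-remove {t} {xs} u t∈xs = ≤-antisym
    (Unique-⊆⇒length-≤ u xs⊆)
    (filter-notAll (λ y → ¬? (y ≟ t)) xs (lose t∈xs (λ t≢t → t≢t refl)))
    where
    xs⊆ : xs ⊆ t ∷ remove t xs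
    xs⊆ {y} y∈xs with y ≟ t
    ... | yes refl = here refl
    ... | no y≢t = there (∈-filter⁺ (λ y → ¬? (y ≟ t)) y∈xs y≢t)

  fixpointFree-involution⇒2∣length : (τ : A → A) → (∀ x → τ (τ x) ≡ x) → ∀ {xs} → Unique xs →
    (∀ {x} → x ∈ xs → τ x ∈ xs) → (∀ {x} → x ∈ xs → τ x ≢ x) → 2 ∣ length xs
  fixpointFree-involution⇒2∣length τ τ-involutive {xs} = go (length xs) ≤-refl
    where
    go : ∀ n {xs} → length xs ≤ n → Unique xs →
         (∀ {x} → x ∈ xs → τ x ∈ xs) → (∀ {x} → x ∈ xs → τ x ≢ x) → 2 ∣ length xs
    go _ {[]} _ _ _ _ = 2 ∣0
    go (suc n) {x ∷ xs} (s≤s |xs|≤n) (x∉xs ∷ xs-unique) closed fixpointFree =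
      subst (λ m → 2 ∣ suc m) (sym (length-remove xs-unique τx∈xs)) (∣m∣n⇒∣m+n ∣-refl 2∣|rest|)
      where
      rest : List A
      rest = remove (τ x) xs
      τx∈xs : τ x ∈ xs
      τx∈xs with closed (here refl)
      ... | here τx≡x = ⊥-elim (fixpointFree (here refl) τx≡x)
      ... | there τx∈xs = τx∈xs
      rest⁻ : ∀ {y} → y ∈ rest → y ∈ xs × y ≢ τ x
      rest⁻ = ∈-filter⁻ (λ y → ¬? (y ≟ τ x))
      rest-closed : ∀ {y} → y ∈ rest → τ y ∈ rest
      rest-closed {y} y∈rest with rest⁻ y∈rest | closed (there (proj₁ (rest⁻ y∈rest)))
      ... | _ , y≢τx | here τy≡x = ⊥-elim (y≢τx (trans (sym (τ-involutive y)) (cong τ τy≡x)))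
      ... | y∈xs , _ | there τy∈xs = ∈-filter⁺ (λ y → ¬? (y ≟ τ x)) τy∈xs λ τy≡τx →
        All.lookup x∉xs y∈xs (trans (sym (τ-involutive x)) (trans (cong τ (sym τy≡τx)) (τ-involutive y)))
      2∣|rest| : 2 ∣ length rest
      2∣|rest| = go n (<⇒≤ (subst (_≤ n) (length-remove xs-unique τx∈xs) |xs|≤n))
        (Uniqueₚ.filter⁺ (λ y → ¬? (y ≟ τ x)) xs-unique) rest-closed (fixpointFree ∘ there ∘ proj₁ ∘ rest⁻)

module _ {A B : Set} {f : A → List B} where

  concatMap-unique : (g : B → A) → (∀ {x y} → y ∈ f x → g y ≡ x) → (∀ x → Unique (f x)) →
                     ∀ {xs} → Unique xs → Unique (concatMap f xs)
  concatMap-unique g g-recovers f-unique xs-unique =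
    Uniqueₚ.concat⁺ (Allₚ.map⁺ (All.universal f-unique _)) (AllPairsₚ.map⁺ (AllPairs.map disjoint xs-unique))
    where
    disjoint : ∀ {x x′} → x ≢ x′ → Disjoint (f x) (f x′)
    disjoint x≢x′ (y∈fx , y∈fx′) = x≢x′ (trans (sym (g-recovers y∈fx)) (g-recovers y∈fx′))

  length-concatMap-const : ∀ {k} → (∀ x → length (f x) ≡ k) → ∀ xs → length (concatMap f xs) ≡ length xs ℕ.* k
  length-concatMap-const _ [] = refl
  length-concatMap-const {k} |f|≡k (x ∷ xs) = begin
    length (f x ++ concatMap f xs)            ≡⟨ length-++ (f x) ⟩
    length (f x) ℕ.+ length (concatMap f xs)  ≡⟨ cong₂ ℕ._+_ (|f|≡k x) (length-concatMap-const |f|≡k xs) ⟩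
    k ℕ.+ length xs ℕ.* k                     ∎
    where open ≡-Reasoning

module _ {q : ℕ} (F : FiniteField q) where
  open FiniteField F
  open IsCommutativeRing isCommutativeRing
    using (+-comm; +-assoc; +-identityˡ; +-identityʳ; -‿inverseʳ; *-comm; *-identityˡ; *-identityʳ; zeroˡ; zeroʳ; distribʳ)

  commutativeRing : CommutativeRing 0ℓ 0ℓ
  commutativeRing = record { isCommutativeRing = isCommutativeRing }

  open Algebra.Properties.Ring (CommutativeRing.ring commutativeRing)
    using (-‿involutive; -0#≈0#; +-cancelˡ; +-inverseˡ-unique)
  open Algebra.Solver.Ring.NaturalCoefficients.Default (CommutativeRing.commutativeSemiring commutativeRing)
    using (solve; _:=_; _:+_; _:*_; con)

  _≟_ : DecidableEquality Carrier
  _≟_ = via-injection (Bijection.injection (sym-≡ enum)) Fin._≟_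

  elements-complete : ∀ x → x ∈ elements F
  elements-complete x = subst (_∈ elements F) (proj₂ (Bijection.surjective enum x) refl) (∈-map⁺ _ (∈-allFin _))

  elements-unique : Unique (elements F)
  elements-unique = Uniqueₚ.map⁺ (Bijection.injective enum) (Uniqueₚ.allFin⁺ q)

  length-elements : length (elements F) ≡ q
  length-elements = trans (length-map (Bijection.to enum) (allFin q)) (length-tabulate id)

  x*y≡0⇒y≡0 : ∀ {x y} → x ≢ 0# → x * y ≡ 0# → y ≡ 0#
  x*y≡0⇒y≡0 {x} {y} x≢0 xy≡0 = let x⁻¹ , xx⁻¹≡1 = inverse x x≢0 in begin
    y              ≡⟨ *-identityˡ y ⟨
    1# * y         ≡⟨ cong (_* y) xx⁻¹≡1 ⟨
    (x * x⁻¹) * y  ≡⟨ solve 3 (λ x x⁻¹ y → (x :* x⁻¹) :* y := x⁻¹ :* (x :* y)) refl x x⁻¹ y ⟩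
    x⁻¹ * (x * y)  ≡⟨ cong (x⁻¹ *_) xy≡0 ⟩
    x⁻¹ * 0#       ≡⟨ zeroʳ x⁻¹ ⟩
    0#             ∎
    where open ≡-Reasoning

  x*x≡0⇒x≡0 : ∀ {x} → x * x ≡ 0# → x ≡ 0#
  x*x≡0⇒x≡0 {x} xx≡0 with x ≟ 0#
  ... | yes x≡0 = x≡0
  ... | no x≢0 = x*y≡0⇒y≡0 x≢0 xx≡0

  [1+1]*x≡x+x : ∀ x → (1# + 1#) * x ≡ x + x
  [1+1]*x≡x+x x = trans (distribʳ x 1# 1#) (cong₂ _+_ (*-identityˡ x) (*-identityˡ x))

  evenOrder⇒1+1≡0 : 2 ∣ q → 1# + 1# ≡ 0#
  evenOrder⇒1+1≡0 2∣q with (1# + 1#) ≟ 0#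
  ... | yes 1+1≡0 = 1+1≡0
  ... | no 1+1≢0 = contradiction (∣1⇒≡1 (∣m+n∣m⇒∣n 2∣|nonzero|+1 2∣|nonzero|)) λ ()
    where
    nonzero : List Carrier
    nonzero = remove _≟_ 0# (elements F)
    nonzero⁻ : ∀ {x} → x ∈ nonzero → x ≢ 0#
    nonzero⁻ x∈ = proj₂ (∈-filter⁻ (λ y → ¬? (y ≟ 0#)) {xs = elements F} x∈)
    nonzero⁺ : ∀ {x} → x ≢ 0# → x ∈ nonzero
    nonzero⁺ x≢0 = ∈-filter⁺ (λ y → ¬? (y ≟ 0#)) (elements-complete _) x≢0
    2∣|nonzero| : 2 ∣ length nonzero
    2∣|nonzero| = fixpointFree-involution⇒2∣length _≟_ -_ -‿involutive
      (Uniqueₚ.filter⁺ (λ y → ¬? (y ≟ 0#)) elements-unique)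
      (λ x∈ → nonzero⁺ λ -x≡0 → nonzero⁻ x∈ (trans (sym (-‿involutive _)) (trans (cong -_ -x≡0) -0#≈0#)))
      (λ {x} x∈ -x≡x → nonzero⁻ x∈ (x*y≡0⇒y≡0 1+1≢0 (trans ([1+1]*x≡x+x x)
        (trans (cong (x +_) (sym -x≡x)) (-‿inverseʳ x)))))
    2∣|nonzero|+1 : 2 ∣ length nonzero ℕ.+ 1
    2∣|nonzero|+1 = subst (2 ∣_)
      (trans (sym length-elements) (trans (length-remove _≟_ elements-unique (elements-complete 0#)) (ℕₚ.+-comm 1 _)))
      2∣q

  allPoints-complete : ∀ S → S ∈ allPoints F
  allPoints-complete (a , b , c) = ∈-concatMap⁺ _ (lose (elements-complete a)
    (∈-concatMap⁺ _ (lose (elements-complete b) (∈-map⁺ _ (elements-complete c)))))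

  allPoints-unique : Unique (allPoints F)
  allPoints-unique = concatMap-unique proj₁ first-coordinate
    (λ a → concatMap-unique (proj₁ ∘ proj₂) second-coordinate
      (λ b → Uniqueₚ.map⁺ (cong (proj₂ ∘ proj₂)) elements-unique) elements-unique)
    elements-unique
    where
    second-coordinate : ∀ {a b : Carrier} {S} → S ∈ map (λ c → a , b , c) (elements F) → proj₁ (proj₂ S) ≡ b
    second-coordinate S∈ = let _ , _ , S≡abc = ∈-map⁻ _ S∈ in cong (proj₁ ∘ proj₂) S≡abc
    first-coordinate : ∀ {a : Carrier} {S} → S ∈ concatMap (λ b → map (λ c → a , b , c) (elements F)) (elements F) →
                       proj₁ S ≡ a
    first-coordinate S∈ = let _ , S∈row = Any.satisfied (∈-concatMap⁻ (λ b → map (λ c → _ , b , c) (elements F)) {xs = elements F} S∈)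
                              _ , _ , S≡abc = ∈-map⁻ _ S∈row
                          in cong proj₁ S≡abc

  _≟ₚ_ : DecidableEquality (Point F)
  _≟ₚ_ = ≡-dec _≟_ (≡-dec _≟_ _≟_)

  module _ (1+1≡0 : 1# + 1# ≡ 0#) where

    x+x≡0 : ∀ x → x + x ≡ 0#
    x+x≡0 x = trans (sym ([1+1]*x≡x+x x)) (trans (cong (_* x) 1+1≡0) (zeroˡ x))

    -x≡x : ∀ x → - x ≡ x
    -x≡x x = sym (+-inverseˡ-unique x x (x+x≡0 x))

    x+y≡0⇒x≡y : ∀ {x y} → x + y ≡ 0# → x ≡ y
    x+y≡0⇒x≡y {x} {y} x+y≡0 = trans (+-inverseˡ-unique x y x+y≡0) (-x≡x y)

    x≡y⇒x+y≡0 : ∀ {x y} → x ≡ y → x + y ≡ 0#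
    x≡y⇒x+y≡0 {x} refl = x+x≡0 x

    +-cancel-shared : ∀ p a b → (p + a) + (p + b) ≡ a + b
    +-cancel-shared p a b = begin
      (p + a) + (p + b)  ≡⟨ solve 3 (λ p a b → (p :+ a) :+ (p :+ b) := (a :+ b) :+ (p :+ p)) refl p a b ⟩
      (a + b) + (p + p)  ≡⟨ cong ((a + b) +_) (x+x≡0 p) ⟩
      (a + b) + 0#       ≡⟨ +-identityʳ (a + b) ⟩
      a + b              ∎
      where open ≡-Reasoning

    square-+ : ∀ x y → (x + y) * (x + y) ≡ x * x + y * y
    square-+ x y = begin
      (x + y) * (x + y)                ≡⟨ solve 2 (λ x y → (x :+ y) :* (x :+ y) := (x :* x :+ y :* y) :+ (x :* y :+ x :* y)) refl x y ⟩
      (x * x + y * y) + (x * y + x * y) ≡⟨ cong ((x * x + y * y) +_) (x+x≡0 (x * y)) ⟩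
      (x * x + y * y) + 0#             ≡⟨ +-identityʳ _ ⟩
      x * x + y * y                    ∎
      where open ≡-Reasoning

    infixl 6 _⊕_
    infixr 7 _·_

    _⊕_ : Point F → Point F → Point F
    (a , b , c) ⊕ (a′ , b′ , c′) = a + a′ , b + b′ , c + c′

    _·_ : Carrier → Point F → Point F
    μ · (a , b , c) = μ * a , μ * b , μ * c

    O : Point F
    O = zeroPoint F

    ≡-point : ∀ {a a′ b b′ c c′ : Carrier} → a ≡ a′ → b ≡ b′ → c ≡ c′ → (a , b , c) ≡ (a′ , b′ , c′)
    ≡-point refl refl refl = refl

    −ₚ≡⊕ : ∀ S S′ → _−ₚ_ F S S′ ≡ S ⊕ S′
    −ₚ≡⊕ _ (a′ , b′ , c′) = ≡-point (cong (_ +_) (-x≡x a′)) (cong (_ +_) (-x≡x b′)) (cong (_ +_) (-x≡x c′))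

    ⊕-self : ∀ S → S ⊕ S ≡ O
    ⊕-self (a , b , c) = ≡-point (x+x≡0 a) (x+x≡0 b) (x+x≡0 c)

    ⊕-cancel-shared : ∀ P A B → (P ⊕ A) ⊕ (P ⊕ B) ≡ A ⊕ B
    ⊕-cancel-shared (p , p′ , p″) (a , a′ , a″) (b , b′ , b″) =
      ≡-point (+-cancel-shared p a b) (+-cancel-shared p′ a′ b′) (+-cancel-shared p″ a″ b″)

    ⊕-cancelˡ : ∀ P X → P ⊕ (P ⊕ X) ≡ X
    ⊕-cancelˡ (p , p′ , p″) (x , x′ , x″) = ≡-point (cancel p x) (cancel p′ x′) (cancel p″ x″)
      where
      cancel : ∀ p x → p + (p + x) ≡ x
      cancel p x = trans (sym (+-assoc p p x)) (trans (cong (_+ x) (x+x≡0 p)) (+-identityˡ x))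

    ⊕-0· : ∀ P R → P ⊕ 0# · R ≡ P
    ⊕-0· (p , p′ , p″) (r , r′ , r″) = ≡-point (vanish p r) (vanish p′ r′) (vanish p″ r″)
      where
      vanish : ∀ p r → p + 0# * r ≡ p
      vanish p r = trans (cong (p +_) (zeroˡ r)) (+-identityʳ p)

    ·-distribʳ : ∀ μ ν R → μ · R ⊕ ν · R ≡ (μ + ν) · R
    ·-distribʳ μ ν (a , b , c) = ≡-point (sym (distribʳ a μ ν)) (sym (distribʳ b μ ν)) (sym (distribʳ c μ ν))

    Singular : Point F → Set
    Singular (a , b , c) = a * c ≡ b * b

    RankOne : Point F → Set
    RankOne S = S ≢ O × Singular S

    det≡0⇔Singular : ∀ {S} → det F S ≡ 0# ⇔ Singular S
    det≡0⇔Singular {a , b , c} = mk⇔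
      (λ det≡0 → x+y≡0⇒x≡y (trans (cong (a * c +_) (sym (-x≡x (b * b)))) det≡0))
      (λ ac≡bb → trans (cong (a * c +_) (-x≡x (b * b))) (x≡y⇒x+y≡0 ac≡bb))

    adjacent⇔RankOne : ∀ S S′ → Adjacent F S S′ ⇔ RankOne (S ⊕ S′)
    adjacent⇔RankOne S S′ = subst (λ D → Rank1 F D ⇔ RankOne (S ⊕ S′)) (sym (−ₚ≡⊕ S S′))
      (mk⇔ (Product.map₂ (Equivalence.to det≡0⇔Singular)) (Product.map₂ (Equivalence.from det≡0⇔Singular)))

    adjacent⇒≢ : ∀ {S S′} → Adjacent F S S′ → S ≢ S′
    adjacent⇒≢ {S} S~S′ refl = proj₁ (Equivalence.to (adjacent⇔RankOne S S) S~S′) (⊕-self S)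

    ·-RankOne : ∀ {κ R} → κ ≢ 0# → RankOne R → RankOne (κ · R)
    ·-RankOne {κ} {a , b , c} κ≢0 (R≢O , ac≡bb) =
      (λ κR≡O → R≢O (≡-point (x*y≡0⇒y≡0 κ≢0 (cong proj₁ κR≡O)) (x*y≡0⇒y≡0 κ≢0 (cong (proj₁ ∘ proj₂) κR≡O))
                             (x*y≡0⇒y≡0 κ≢0 (cong (proj₂ ∘ proj₂) κR≡O)))) ,
      (begin
        (κ * a) * (κ * c)  ≡⟨ solve 3 (λ κ a c → (κ :* a) :* (κ :* c) := (κ :* κ) :* (a :* c)) refl κ a c ⟩
        (κ * κ) * (a * c)  ≡⟨ cong ((κ * κ) *_) ac≡bb ⟩
        (κ * κ) * (b * b)  ≡⟨ solve 2 (λ κ b → (κ :* κ) :* (b :* b) := (κ :* b) :* (κ :* b)) refl κ b ⟩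
        (κ * b) * (κ * b)  ∎)
      where open ≡-Reasoning

    singular-O : Singular O
    singular-O = refl

    swap : Point F → Point F
    swap (a , b , c) = c , b , a

    singular-swap : ∀ {S} → Singular S → Singular (swap S)
    singular-swap {a , b , c} ac≡bb = trans (*-comm c a) ac≡bb

    -- In characteristic 2, det (R ⊕ S) = det R + det S + (a₁ c₂ + a₂ c₁).
    singular-⊕⇒cross : ∀ {a₁ b₁ c₁ a₂ b₂ c₂} → Singular (a₁ , b₁ , c₁) → Singular (a₂ , b₂ , c₂) →
                       Singular ((a₁ , b₁ , c₁) ⊕ (a₂ , b₂ , c₂)) → a₁ * c₂ ≡ a₂ * c₁
    singular-⊕⇒cross {a₁} {b₁} {c₁} {a₂} {b₂} {c₂} a₁c₁≡b₁b₁ a₂c₂≡b₂b₂ sum-singular =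
      x+y≡0⇒x≡y (+-cancelˡ U _ 0# (begin
        U + (a₁ * c₂ + a₂ * c₁)  ≡⟨ solve 4 (λ a₁ a₂ c₁ c₂ → (a₁ :* c₁ :+ a₂ :* c₂) :+ (a₁ :* c₂ :+ a₂ :* c₁)
                                                        := (a₁ :+ a₂) :* (c₁ :+ c₂)) refl a₁ a₂ c₁ c₂ ⟩
        (a₁ + a₂) * (c₁ + c₂)    ≡⟨ sum-singular ⟩
        (b₁ + b₂) * (b₁ + b₂)    ≡⟨ square-+ b₁ b₂ ⟩
        b₁ * b₁ + b₂ * b₂        ≡⟨ cong₂ _+_ a₁c₁≡b₁b₁ a₂c₂≡b₂b₂ ⟨
        U                        ≡⟨ +-identityʳ U ⟨
        U + 0#                   ∎))
      where
      open ≡-Reasoning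
      U : Carrier
      U = a₁ * c₁ + a₂ * c₂

    -- μ = a₂ / a₁; the b-coordinate follows since (b₂ + μ b₁)² = 0.
    collinear-a≢0 : ∀ {R S} → proj₁ R ≢ 0# → Singular R → Singular S → Singular (R ⊕ S) → ∃ λ μ → S ≡ μ · R
    collinear-a≢0 {a₁ , b₁ , c₁} {a₂ , b₂ , c₂} a₁≢0 a₁c₁≡b₁b₁ a₂c₂≡b₂b₂ sum-singular =
      μ , ≡-point (sym μa₁≡a₂) (x+y≡0⇒x≡y (x*x≡0⇒x≡0 [b₂+μb₁]²≡0)) (sym μc₁≡c₂)
      where
      open ≡-Reasoning
      a₁⁻¹ μ : Carrier
      a₁⁻¹ = proj₁ (inverse a₁ a₁≢0)
      μ = a₂ * a₁⁻¹
      μa₁≡a₂ : μ * a₁ ≡ a₂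
      μa₁≡a₂ = begin
        a₂ * a₁⁻¹ * a₁    ≡⟨ solve 3 (λ a₂ a₁⁻¹ a₁ → a₂ :* a₁⁻¹ :* a₁ := a₂ :* (a₁ :* a₁⁻¹)) refl a₂ a₁⁻¹ a₁ ⟩
        a₂ * (a₁ * a₁⁻¹)  ≡⟨ cong (a₂ *_) (proj₂ (inverse a₁ a₁≢0)) ⟩
        a₂ * 1#           ≡⟨ *-identityʳ a₂ ⟩
        a₂                ∎
      μc₁≡c₂ : μ * c₁ ≡ c₂
      μc₁≡c₂ = begin
        a₂ * a₁⁻¹ * c₁      ≡⟨ solve 3 (λ a₂ a₁⁻¹ c₁ → a₂ :* a₁⁻¹ :* c₁ := a₁⁻¹ :* (a₂ :* c₁)) refl a₂ a₁⁻¹ c₁ ⟩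
        a₁⁻¹ * (a₂ * c₁)    ≡⟨ cong (a₁⁻¹ *_) (singular-⊕⇒cross a₁c₁≡b₁b₁ a₂c₂≡b₂b₂ sum-singular) ⟨
        a₁⁻¹ * (a₁ * c₂)    ≡⟨ solve 3 (λ a₁⁻¹ a₁ c₂ → a₁⁻¹ :* (a₁ :* c₂) := (a₁ :* a₁⁻¹) :* c₂) refl a₁⁻¹ a₁ c₂ ⟩
        (a₁ * a₁⁻¹) * c₂    ≡⟨ cong (_* c₂) (proj₂ (inverse a₁ a₁≢0)) ⟩
        1# * c₂             ≡⟨ *-identityˡ c₂ ⟩
        c₂                  ∎
      [b₂+μb₁]²≡0 : (b₂ + μ * b₁) * (b₂ + μ * b₁) ≡ 0#
      [b₂+μb₁]²≡0 = begin
        (b₂ + μ * b₁) * (b₂ + μ * b₁)              ≡⟨ square-+ b₂ (μ * b₁) ⟩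
        b₂ * b₂ + (μ * b₁) * (μ * b₁)              ≡⟨ cong₂ _+_ a₂c₂≡b₂b₂ (solve 2 (λ μ b₁ → (μ :* μ) :* (b₁ :* b₁)
                                                                            := (μ :* b₁) :* (μ :* b₁)) refl μ b₁) ⟨
        a₂ * c₂ + (μ * μ) * (b₁ * b₁)              ≡⟨ cong₂ (λ x y → x + (μ * μ) * y)
                                                        (cong₂ _*_ μa₁≡a₂ μc₁≡c₂) a₁c₁≡b₁b₁ ⟨
        (μ * a₁) * (μ * c₁) + (μ * μ) * (a₁ * c₁)  ≡⟨ cong (_+ (μ * μ) * (a₁ * c₁)) (solve 3 (λ μ a₁ c₁ →
                                                        (μ :* a₁) :* (μ :* c₁) := (μ :* μ) :* (a₁ :* c₁)) refl μ a₁ c₁) ⟩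
        (μ * μ) * (a₁ * c₁) + (μ * μ) * (a₁ * c₁)  ≡⟨ x+x≡0 _ ⟩
        0#                                         ∎

    collinear : ∀ {R S} → RankOne R → Singular S → Singular (R ⊕ S) → ∃ λ μ → S ≡ μ · R
    collinear {a , b , c} (R≢O , ac≡bb) S-singular sum-singular with a ≟ 0#
    ... | no a≢0 = collinear-a≢0 a≢0 ac≡bb S-singular sum-singular
    ... | yes refl =
      let μ , swapS≡μ·swapR = collinear-a≢0 c≢0 (singular-swap ac≡bb) (singular-swap S-singular) (singular-swap sum-singular)
      in μ , cong swap swapS≡μ·swapR
      where
      c≢0 : c ≢ 0#
      c≢0 refl = R≢O (≡-point refl (x*x≡0⇒x≡0 (trans (sym ac≡bb) (zeroˡ 0#))) refl)

    affineLine-adjacent : ∀ P {R} → RankOne R → ∀ {μ ν} → μ ≢ ν → Adjacent F (P ⊕ μ · R) (P ⊕ ν · R)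
    affineLine-adjacent P {R} R-rankOne {μ} {ν} μ≢ν = Equivalence.from (adjacent⇔RankOne _ _)
      (subst RankOne (sym (trans (⊕-cancel-shared P (μ · R) (ν · R)) (·-distribʳ μ ν R)))
        (·-RankOne (μ≢ν ∘ x+y≡0⇒x≡y) R-rankOne))

    line-singular : ∀ {M} → IsLine F M → ∀ {X Y} → M X ≡ true → M Y ≡ true → Singular (X ⊕ Y)
    line-singular (pairwise-adjacent , _) {X} {Y} MX MY with X ≟ₚ Y
    ... | yes refl = subst Singular (sym (⊕-self X)) singular-O
    ... | no X≢Y = proj₂ (Equivalence.to (adjacent⇔RankOne X Y) (pairwise-adjacent X Y MX MY X≢Y))

    line⊆affineLine : ∀ {M} → IsLine F M → ∀ {P P′} → M P ≡ true → M P′ ≡ true → P ≢ P′ →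
                      ∀ {X} → M X ≡ true → ∃ λ μ → X ≡ P ⊕ μ · (P ⊕ P′)
    line⊆affineLine line {P} {P′} MP MP′ P≢P′ {X} MX =
      let μ , P⊕X≡μR = collinear (Equivalence.to (adjacent⇔RankOne P P′) (proj₁ line P P′ MP MP′ P≢P′))
                                 (line-singular line MP MX)
                                 (subst Singular (sym (⊕-cancel-shared P P′ X)) (line-singular line MP′ MX))
      in μ , trans (sym (⊕-cancelˡ P X)) (cong (P ⊕_) P⊕X≡μR)

    affineLine⊆line : ∀ {M} → IsLine F M → ∀ {P R} → RankOne R →
                      (∀ {X} → M X ≡ true → ∃ λ μ → X ≡ P ⊕ μ · R) → ∀ μ → M (P ⊕ μ · R) ≡ true
    affineLine⊆line {M} (_ , maximal) {P} {R} R-rankOne on-affineLine μ with M (P ⊕ μ · R) in eq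
    ... | true = refl
    ... | false = ⊥-elim (maximal _ eq adjacent-to-line)
      where
      adjacent-to-line : ∀ S → M S ≡ true → Adjacent F (P ⊕ μ · R) S
      adjacent-to-line S MS with on-affineLine MS
      ... | ν , refl with μ ≟ ν
      ...   | yes refl = contradiction (trans (sym eq) MS) λ ()
      ...   | no μ≢ν = affineLine-adjacent P R-rankOne μ≢ν

    -- If P were alone on M, its neighbour P ⊕ e would contradict maximality.
    line-secondPoint : ∀ {M} → IsLine F M → ∀ {P} → M P ≡ true → ∃ λ P′ → M P′ ≡ true × P ≢ P′
    line-secondPoint {M} (_ , maximal) {P} MP with any? (λ S → (M S Bool.≟ true) ×-dec ¬? (P ≟ₚ S)) (allPoints F)
    ... | yes found = let P′ , _ , P′-other = find found in P′ , P′-other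
    ... | no none = ⊥-elim (maximal _ Y∉M λ S MS → subst (Adjacent F Y) (only-P MS) Y~P)
      where
      only-P : ∀ {S} → M S ≡ true → P ≡ S
      only-P {S} MS = decidable-stable (P ≟ₚ S) λ P≢S → All.lookup (¬Any⇒All¬ _ none) (allPoints-complete S) (MS , P≢S)
      e : Point F
      e = 0# , 0# , 1#
      e-rankOne : RankOne e
      e-rankOne = (λ e≡O → 0≢1 (sym (cong (proj₂ ∘ proj₂) e≡O))) , trans (zeroˡ 1#) (sym (zeroˡ 0#))
      Y : Point F
      Y = P ⊕ 1# · e
      Y~P : Adjacent F Y P
      Y~P = subst (Adjacent F Y) (⊕-0· P e) (affineLine-adjacent P e-rankOne (0≢1 ∘ sym))
      Y∉M : M Y ≡ false
      Y∉M with M Y in eq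
      ... | true = ⊥-elim (adjacent⇒≢ Y~P (sym (only-P eq)))
      ... | false = refl

    Bit : Carrier → Set
    Bit x = x ≡ 0# ⊎ x ≡ 1#

    bit? : ∀ x → Dec (Bit x)
    bit? x = (x ≟ 0#) ⊎-dec (x ≟ 1#)

    Support : Point F → Set
    Support (a , b , c) = Bit a × Bit (c + b * b)

    support? : ∀ S → Dec (Support S)
    support? (a , b , c) = bit? a ×-dec bit? (c + b * b)

    support : Point F → Bool
    support S = does (support? S)

    Bit-+ : ∀ {x y} → Bit x → Bit (x + y) ⇔ Bit y
    Bit-+ {y = y} (inj₁ refl) = mk⇔ (subst Bit (+-identityˡ y)) (subst Bit (sym (+-identityˡ y)))
    Bit-+ {y = y} (inj₂ refl) = mk⇔ to from
      where
      to : Bit (1# + y) → Bit y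
      to (inj₁ 1+y≡0) = inj₂ (sym (x+y≡0⇒x≡y 1+y≡0))
      to (inj₂ 1+y≡1) = inj₁ (+-cancelˡ 1# y 0# (trans 1+y≡1 (sym (+-identityʳ 1#))))
      from : Bit y → Bit (1# + y)
      from (inj₁ refl) = inj₂ (+-identityʳ 1#)
      from (inj₂ refl) = inj₁ 1+1≡0

    Bit-* : ∀ {ℓ ℓ⁻¹ μ} → ℓ * ℓ⁻¹ ≡ 1# → Bit (μ * ℓ) ⇔ (μ ≡ 0# ⊎ μ ≡ ℓ⁻¹)
    Bit-* {ℓ} {ℓ⁻¹} {μ} ℓℓ⁻¹≡1 = mk⇔ (Sum.map (λ μℓ≡0 → trans μ≡μℓℓ⁻¹ (trans (cong (_* ℓ⁻¹) μℓ≡0) (zeroˡ ℓ⁻¹)))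
                                              (λ μℓ≡1 → trans μ≡μℓℓ⁻¹ (trans (cong (_* ℓ⁻¹) μℓ≡1) (*-identityˡ ℓ⁻¹))))
                                     (Sum.map (λ { refl → zeroˡ ℓ }) (λ { refl → trans (*-comm ℓ⁻¹ ℓ) ℓℓ⁻¹≡1 }))
      where
      μ≡μℓℓ⁻¹ : μ ≡ μ * ℓ * ℓ⁻¹
      μ≡μℓℓ⁻¹ = sym (trans (solve 3 (λ μ ℓ ℓ⁻¹ → μ :* ℓ :* ℓ⁻¹ := μ :* (ℓ :* ℓ⁻¹)) refl μ ℓ ℓ⁻¹)
                          (trans (cong (μ *_) ℓℓ⁻¹≡1) (*-identityʳ μ)))

    c+b²-along : ∀ {p₂ p₃ r₁ r₂ r₃} → r₁ * r₃ ≡ r₂ * r₂ → ∀ μ →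
      (p₃ + μ * r₃) + (p₂ + μ * r₂) * (p₂ + μ * r₂) ≡ (p₃ + p₂ * p₂) + μ * r₃ * (1# + μ * r₁)
    c+b²-along {p₂} {p₃} {r₁} {r₂} {r₃} r₁r₃≡r₂r₂ μ = begin
      (p₃ + μ * r₃) + (p₂ + μ * r₂) * (p₂ + μ * r₂)    ≡⟨ cong ((p₃ + μ * r₃) +_) (square-+ p₂ (μ * r₂)) ⟩
      (p₃ + μ * r₃) + (p₂ * p₂ + (μ * r₂) * (μ * r₂))  ≡⟨ cong (λ z → (p₃ + μ * r₃) + (p₂ * p₂ + z))
                                                          (solve 2 (λ μ r₂ → (μ :* r₂) :* (μ :* r₂) := (μ :* μ) :* (r₂ :* r₂)) refl μ r₂) ⟩
      (p₃ + μ * r₃) + (p₂ * p₂ + (μ * μ) * (r₂ * r₂))  ≡⟨ cong (λ z → (p₃ + μ * r₃) + (p₂ * p₂ + (μ * μ) * z)) r₁r₃≡r₂r₂ ⟨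
      (p₃ + μ * r₃) + (p₂ * p₂ + (μ * μ) * (r₁ * r₃))  ≡⟨ solve 5 (λ p₂ p₃ r₁ r₃ μ →
                                                             (p₃ :+ μ :* r₃) :+ (p₂ :* p₂ :+ (μ :* μ) :* (r₁ :* r₃))
                                                          := (p₃ :+ p₂ :* p₂) :+ μ :* r₃ :* (con 1 :+ μ :* r₁)) refl p₂ p₃ r₁ r₃ μ ⟩
      (p₃ + p₂ * p₂) + μ * r₃ * (1# + μ * r₁)          ∎
      where open ≡-Reasoning

    -- Along the line, c + b² = s + μ r₃ (1 + μ r₁) with s its value at P. If r₁ ≢ 0, the condition
    -- on a forces μ r₁ ∈ {0 , 1}, which kills μ r₃ (1 + μ r₁); if r₁ = 0, a is constant on the line.
    support-along-affineLine : ∀ {P R} → RankOne R → Support P →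
                               ∃ λ ℓ → ℓ ≢ 0# × ∀ μ → Support (P ⊕ μ · R) ⇔ Bit (μ * ℓ)
    support-along-affineLine {p₁ , p₂ , p₃} {r₁ , r₂ , r₃} (R≢O , r₁r₃≡r₂r₂) (bit-p₁ , bit-s) with r₁ ≟ 0#
    ... | no r₁≢0 = r₁ , r₁≢0 , λ μ → mk⇔
      (λ (bit-a , _) → Equivalence.to (Bit-+ bit-p₁) bit-a)
      (λ bit-μr₁ → Equivalence.from (Bit-+ bit-p₁) bit-μr₁ ,
        subst Bit (sym (trans (c+b²-along r₁r₃≡r₂r₂ μ) (trans (cong (_ +_) (vanish μ bit-μr₁)) (+-identityʳ _)))) bit-s)
      where
      vanish : ∀ μ → Bit (μ * r₁) → μ * r₃ * (1# + μ * r₁) ≡ 0#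
      vanish μ (inj₁ μr₁≡0) = begin
        μ * r₃ * (1# + μ * r₁)   ≡⟨ cong (λ z → z * r₃ * (1# + μ * r₁)) (x*y≡0⇒y≡0 r₁≢0 (trans (*-comm r₁ μ) μr₁≡0)) ⟩
        0# * r₃ * (1# + μ * r₁)  ≡⟨ cong (_* (1# + μ * r₁)) (zeroˡ r₃) ⟩
        0# * (1# + μ * r₁)       ≡⟨ zeroˡ _ ⟩
        0#                       ∎
        where open ≡-Reasoning
      vanish μ (inj₂ μr₁≡1) = trans (cong (λ z → μ * r₃ * (1# + z)) μr₁≡1) (trans (cong (μ * r₃ *_) 1+1≡0) (zeroʳ _))
    ... | yes refl = r₃ , r₃≢0 , λ μ → mk⇔
      (λ (_ , bit-c+b²) → Equivalence.to (Bit-+ bit-s) (subst Bit (c+b²≡ μ) bit-c+b²))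
      (λ bit-μr₃ → subst Bit (sym (x+μ0≡x p₁ μ)) bit-p₁ , subst Bit (sym (c+b²≡ μ)) (Equivalence.from (Bit-+ bit-s) bit-μr₃))
      where
      r₃≢0 : r₃ ≢ 0#
      r₃≢0 refl = R≢O (≡-point refl (x*x≡0⇒x≡0 (trans (sym r₁r₃≡r₂r₂) (zeroˡ 0#))) refl)
      x+μ0≡x : ∀ x μ → x + μ * 0# ≡ x
      x+μ0≡x x μ = trans (cong (x +_) (zeroʳ μ)) (+-identityʳ x)
      c+b²≡ : ∀ μ → (p₃ + μ * r₃) + (p₂ + μ * r₂) * (p₂ + μ * r₂) ≡ (p₃ + p₂ * p₂) + μ * r₃
      c+b²≡ μ = trans (c+b²-along r₁r₃≡r₂r₂ μ) (cong ((p₃ + p₂ * p₂) +_)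
        (trans (cong (λ z → μ * r₃ * z) (x+μ0≡x 1# μ)) (*-identityʳ (μ * r₃))))

    support-meets-affineLine : ∀ {P R} → RankOne R → Support P →
                               ∃ λ ν → ν ≢ 0# × ∀ μ → Support (P ⊕ μ · R) ⇔ (μ ≡ 0# ⊎ μ ≡ ν)
    support-meets-affineLine R-rankOne P-support =
      let ℓ , ℓ≢0 , along = support-along-affineLine R-rankOne P-support
          ℓ⁻¹ , ℓℓ⁻¹≡1 = inverse ℓ ℓ≢0
      in ℓ⁻¹ , (λ ℓ⁻¹≡0 → 0≢1 (trans (sym (zeroʳ ℓ)) (trans (cong (ℓ *_) (sym ℓ⁻¹≡0)) ℓℓ⁻¹≡1))) ,
         λ μ → Bit-* ℓℓ⁻¹≡1 ⇔-∘ along μ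

    support⇒Support : ∀ {S} → support S ≡ true → Support S
    support⇒Support {S} = does≡true⇒ (support? S)

    affineLine-meets-support-twice : ∀ {M} → IsLine F M → ∀ {P R ν} → RankOne R → ν ≢ 0# →
      (∀ μ → Support (P ⊕ μ · R) ⇔ (μ ≡ 0# ⊎ μ ≡ ν)) → M P ≡ true → Support P →
      (∀ {X} → M X ≡ true → ∃ λ μ → X ≡ P ⊕ μ · R) → count (λ S → M S ∧ support S) (allPoints F) ≡ 2
    affineLine-meets-support-twice {M} line {P} {R} {ν} R-rankOne ν≢0 support⇔ MP P-support on-affineLine =
      count-≡2 allPoints-unique (allPoints-complete P) (allPoints-complete Q) P≢Q (λ _ → mk⇔ selected⇒ selected⇐)
      where
      Q : Point F
      Q = P ⊕ ν · R
      P≢Q : P ≢ Q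
      P≢Q = subst (_≢ Q) (⊕-0· P R) (adjacent⇒≢ (affineLine-adjacent P R-rankOne (ν≢0 ∘ sym)))
      selected⇒ : ∀ {S} → (M S ∧ support S) ≡ true → S ≡ P ⊎ S ≡ Q
      selected⇒ {S} selected with on-affineLine (Bool.∧-conicalˡ _ _ selected)
      ... | μ , refl = Sum.map (λ μ≡0 → trans (cong (λ z → P ⊕ z · R) μ≡0) (⊕-0· P R)) (cong (λ z → P ⊕ z · R))
        (Equivalence.to (support⇔ μ) (support⇒Support (Bool.∧-conicalʳ (M _) _ selected)))
      selected⇐ : ∀ {S} → S ≡ P ⊎ S ≡ Q → (M S ∧ support S) ≡ true
      selected⇐ (inj₁ refl) = cong₂ _∧_ MP (dec-true (support? P) P-support)
      selected⇐ (inj₂ refl) = cong₂ _∧_ (affineLine⊆line line R-rankOne on-affineLine ν)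
        (dec-true (support? Q) (Equivalence.from (support⇔ ν) (inj₂ refl)))

    line-through-support-point : ∀ {M} → IsLine F M → ∀ {P} → M P ≡ true → Support P →
                                 count (λ S → M S ∧ support S) (allPoints F) ≡ 2
    line-through-support-point line {P} MP P-support =
      let P′ , MP′ , P≢P′ = line-secondPoint line MP
          R-rankOne = Equivalence.to (adjacent⇔RankOne P P′) (proj₁ line P P′ MP MP′ P≢P′)
          ν , ν≢0 , support⇔ = support-meets-affineLine R-rankOne P-support
      in affineLine-meets-support-twice line R-rankOne ν≢0 support⇔ MP P-support (line⊆affineLine line MP MP′ P≢P′)

    line-meets-support-evenly : ∀ {M} → IsLine F M → 2 ∣ card F (λ S → M S ∧ support S)
    line-meets-support-evenly {M} line with any? (λ S → T? (M S ∧ support S)) (allPoints F)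
    ... | no none = subst (2 ∣_) (sym (count-≡0 none)) (2 ∣0)
    ... | yes some =
      let P , _ , selected = find some
          MP∧supportP = Equivalence.to T-≡ selected
      in divides 1 (line-through-support-point line (Bool.∧-conicalˡ (M P) _ MP∧supportP)
                      (support⇒Support (Bool.∧-conicalʳ (M P) _ MP∧supportP)))

    candidates : Carrier → Carrier → List (Point F)
    candidates a b = (a , b , b * b) ∷ (a , b , 1# + b * b) ∷ []

    supportCandidates : List (Point F)
    supportCandidates = concatMap (λ a → concatMap (candidates a) (elements F)) (0# ∷ 1# ∷ [])

    length-supportCandidates : length supportCandidates ≡ 4 ℕ.* q
    length-supportCandidates = begin
      length supportCandidates           ≡⟨ length-concatMap-const {f = λ a → concatMap (candidates a) (elements F)}
                                              (λ a → length-concatMap-const {f = candidates a} (λ _ → refl) (elements F))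
                                              (0# ∷ 1# ∷ []) ⟩
      2 ℕ.* (length (elements F) ℕ.* 2)  ≡⟨ cong (λ n → 2 ℕ.* (n ℕ.* 2)) length-elements ⟩
      2 ℕ.* (q ℕ.* 2)                    ≡⟨ cong (2 ℕ.*_) (ℕₚ.*-comm q 2) ⟩
      2 ℕ.* (2 ℕ.* q)                    ≡⟨ ℕₚ.*-assoc 2 2 q ⟨
      4 ℕ.* q                            ∎
      where open ≡-Reasoning

    Support⇒∈supportCandidates : ∀ {S} → Support S → S ∈ supportCandidates
    Support⇒∈supportCandidates {a , b , c} (bit-a , bit-c+b²) =
      ∈-concatMap⁺ (λ a → concatMap (candidates a) (elements F))
        (lose (first bit-a) (∈-concatMap⁺ (candidates a) (lose (elements-complete b) (third bit-c+b²))))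
      where
      first : Bit a → a ∈ 0# ∷ 1# ∷ []
      first (inj₁ refl) = here refl
      first (inj₂ refl) = there (here refl)
      third : Bit (c + b * b) → (a , b , c) ∈ candidates a b
      third (inj₁ c+b²≡0) = here (cong (λ z → a , b , z) (x+y≡0⇒x≡y c+b²≡0))
      third (inj₂ c+b²≡1) = there (here (cong (λ z → a , b , z) (x+y≡0⇒x≡y (begin
        c + (1# + b * b)  ≡⟨ solve 2 (λ c b → c :+ (con 1 :+ b :* b) := (c :+ b :* b) :+ con 1) refl c b ⟩
        (c + b * b) + 1#  ≡⟨ cong (_+ 1#) c+b²≡1 ⟩
        1# + 1#           ≡⟨ 1+1≡0 ⟩
        0#                ∎))))
        where open ≡-Reasoning

    weight-support : weight F support ≤ 4 ℕ.* q
    weight-support = ≤-trans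
      (Unique-⊆⇒length-≤ (Uniqueₚ.filter⁺ (T? ∘ support) allPoints-unique)
        (λ S∈ → Support⇒∈supportCandidates (support⇒Support (Equivalence.to T-≡ (proj₂ (∈-filter⁻ (T? ∘ support) {xs = allPoints F} S∈))))))
      (≤-reflexive length-supportCandidates)

    support-isCodeword : IsCodeword F support
    support-isCodeword _ = line-meets-support-evenly

    minDistance≤4q : MinDistanceAtMost F (4 ℕ.* q)
    minDistance≤4q = support , support-isCodeword , (O , dec-true (support? O) O-support) , weight-support
      where
      O-support : Support O
      O-support = inj₁ refl , inj₁ (trans (+-identityˡ _) (zeroˡ 0#))

open import Data.Nat using (_^_; _*_)

lemma7 : (k : ℕ) (F : FiniteField (2 ^ suc k)) →
    MinDistanceAtMost F (4 * (2 ^ suc k))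
lemma7 k F = minDistance≤4q F (evenOrder⇒1+1≡0 F (m∣m*n (2 ^ k)))
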